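{- Let $K$ be a positive integer and let $(a,b,c)$ be a triple of positive integers with $a=2K$, $a\geq b$, $a\geq c$, $b+c=2K+2$, $b$ and $c$ both even, and $\gcd(b,c)=2$. Then $(a,b,c)$ is a good triple.
   Context: For positive integers $a,b,c$ with $n=a+b+c$, the permutation of the triple $(a,b,c)$ is the permutation of $[n]$ with $p_i=n+1-i$ for $1\le i\le a$, $p_i=a+b+1-i$ for $a+1\le i\le a+b$, and $p_i=n+b+1-i$ for $a+b+1\le i\le n$ (one-line notation $n\cdots(n-a+1)\ b\cdots1\ (b+c)\cdots(b+1)$). The triple is good if this permutation, as a bijection $i\mapsto p_i$ of $[n]$, is a single $n$-cycle. -}

module Defs where

open import Data.Nat using (ℕ; zero; suc; _+_; _∸_; _≤_; _≤ᵇ_)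
open import Data.Bool using (if_then_else_)
open import Data.Product using (∃)
open import Relation.Binary.PropositionalEquality using (_≡_)

-- The permutation of the triple (a,b,c), as a function on ℕ whose
-- restriction to [n] = {1,…,n}, n = a+b+c, is
--   p i = n+1-i      for 1 ≤ i ≤ a
--   p i = a+b+1-i    for a+1 ≤ i ≤ a+b
--   p i = n+b+1-i    for a+b+1 ≤ i ≤ n
-- (values outside [n] are irrelevant).
triplePerm : ℕ → ℕ → ℕ → ℕ → ℕ
triplePerm a b c i =
  let n = a + b + c in
  if i ≤ᵇ a then (n + 1) ∸ i
  else if i ≤ᵇ a + b then (a + b + 1) ∸ i
  else (n + b + 1) ∸ i

iter : (ℕ → ℕ) → ℕ → ℕ → ℕ
iter f zero    x = x
iter f (suc k) x = f (iter f k x)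

-- A bijection p of [n] is a single n-cycle iff [n] is one orbit,
-- i.e. every j ∈ [n] lies in the orbit of 1.
IsSingleCycle : ℕ → (ℕ → ℕ) → Set
IsSingleCycle n p = ∀ j → 1 ≤ j → j ≤ n → ∃ λ k → iter p k 1 ≡ j

Good : ℕ → ℕ → ℕ → Set
Good a b c = IsSingleCycle (a + b + c) (triplePerm a b c)

-- Write b = 2B, c = 2C; then B + C = N := K + 1 and gcd(B, C) = 1.  The
-- permutation Q of the triple is a reflection on each of its three blocks,
-- so it swaps parities, pairing 1 + 2u with 2t when t + u is the block's
-- constant (module Blocks).  Composing two reflections, Q² acts on the odd
-- numbers 1 + 2w as the translation by B modulo N on the lower half w < K
-- and by C modulo N on the upper half w = K + v, with one jump from each
-- half into the other (module SpecialTriple).  As B and C are units modulo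
-- N, each translation visits every residue before it jumps (the lemmas on
-- progressions modulo n), so the odd numbers form one Q²-orbit through 1;
-- every even number is the Q-image of an odd one, so Q is a single cycle.
module Submission where

open import Defs
open import Data.Nat using (ℕ; _+_; _*_; _≤_; _<_)
open import Data.Nat.Divisibility using (_∣_; divides; ∣⇒≤; ∣m+n∣m⇒∣n)
open import Data.Nat.GCD using (gcd; module Bézout; c*gcd[m,n]≡gcd[cm,cn])
open import Relation.Binary.PropositionalEquality using (_≡_)
open import Data.Nat
  using (zero; suc; _∸_; _≤ᵇ_; _%_; _/_; NonZero; s≤s; z<s; s≤s⁻¹)
open import Data.Nat.Properties
open import Data.Nat.DivMod
  using (m≡m%n+[m/n]*n; m%n%n≡m%n; [m+n]%n≡m%n; [m+kn]%n≡m%n; m%n<n; m<n⇒m%n≡m; %-distribˡ-+)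
open import Data.Nat.Coprimality
  using (Coprime; coprime-Bézout; coprime-divisor; coprime-+; gcd≡1⇒coprime)
  renaming (sym to coprime-sym)
open import Data.Nat.Tactic.RingSolver using (solve-∀)
open import Data.Bool using (true; false; T)
open import Data.Unit using (tt)
open import Data.Empty using (⊥-elim)
open import Data.Product using (∃; _×_; _,_)
open import Data.Sum using (_⊎_; inj₁; inj₂)
open import Function using (_∘_)
open import Relation.Nullary using (Dec; yes; no)
open import Relation.Binary.Definitions using (tri<; tri≈; tri>)
open import Relation.Binary.PropositionalEquality
  using (_≢_; refl; sym; trans; cong; cong₂; subst; subst₂; module ≡-Reasoning)
open ≡-Reasoning

Reach : (ℕ → ℕ) → ℕ → ℕ → Set
Reach f x y = ∃ λ k → iter f k x ≡ y

reach-step : ∀ {f x y} → f x ≡ y → Reach f x y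
reach-step fx≡y = 1 , fx≡y

iter-+ : ∀ f k l x → iter f (k + l) x ≡ iter f k (iter f l x)
iter-+ f zero    l x = refl
iter-+ f (suc k) l x = cong f (iter-+ f k l x)

reach-trans : ∀ {f x y z} → Reach f x y → Reach f y z → Reach f x z
reach-trans {f} {x} {y} {z} (k , fᵏx≡y) (l , fˡy≡z) = l + k , (begin
  iter f (l + k) x        ≡⟨ iter-+ f l k x ⟩
  iter f l (iter f k x)   ≡⟨ cong (iter f l) fᵏx≡y ⟩
  iter f l y              ≡⟨ fˡy≡z ⟩
  z                       ∎)

twice : (ℕ → ℕ) → ℕ → ℕ
twice f x = f (f x)

iter-twice : ∀ f k x → iter (twice f) k x ≡ iter f (k * 2) x
iter-twice f zero    x = refl
iter-twice f (suc k) x = cong (twice f) (iter-twice f k x)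

reach-twice : ∀ {f x y} → Reach (twice f) x y → Reach f x y
reach-twice {f} {x} (k , e) = k * 2 , trans (sym (iter-twice f k x)) e

%-absorb : ∀ x m k n .{{_ : NonZero n}} → (x + (m % n) * k) % n ≡ (x + m * k) % n
%-absorb x m k n = begin
  (x + (m % n) * k) % n                    ≡⟨ [m+kn]%n≡m%n (x + (m % n) * k) ((m / n) * k) n ⟨
  (x + (m % n) * k + (m / n) * k * n) % n  ≡⟨ cong (_% n) (regroup x (m % n) (m / n) k n) ⟩
  (x + (m % n + (m / n) * n) * k) % n      ≡⟨ cong (λ z → (x + z * k) % n) (m≡m%n+[m/n]*n m n) ⟨
  (x + m * k) % n                          ∎
  where
  regroup : ∀ x r d k n → x + r * k + d * k * n ≡ x + (r + d * n) * k
  regroup = solve-∀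

%-absorb-+ : ∀ m k n .{{_ : NonZero n}} → (m % n + k) % n ≡ (m + k) % n
%-absorb-+ m k n = begin
  (m % n + k) % n          ≡⟨ %-distribˡ-+ (m % n) k n ⟩
  (m % n % n + k % n) % n  ≡⟨ cong (λ z → (z + k % n) % n) (m%n%n≡m%n m n) ⟩
  (m % n + k % n) % n      ≡⟨ %-distribˡ-+ m k n ⟨
  (m + k) % n              ∎

mod-cancel : ∀ x k n .{{_ : NonZero n}} → (x + k) % n ≡ x % n → n ∣ k
mod-cancel x k n same = ∣m+n∣m⇒∣n (divides ((x + k) / n) (+-cancelˡ-≡ (x % n) _ _ both)) (divides (x / n) refl)
  where
  both : x % n + (x / n * n + k) ≡ x % n + (x + k) / n * n
  both = begin
    x % n + (x / n * n + k)   ≡⟨ +-assoc (x % n) (x / n * n) k ⟨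
    x % n + x / n * n + k     ≡⟨ cong (_+ k) (m≡m%n+[m/n]*n x n) ⟨
    x + k                     ≡⟨ m≡m%n+[m/n]*n (x + k) n ⟩
    (x + k) % n + (x + k) / n * n ≡⟨ cong (_+ (x + k) / n * n) same ⟩
    x % n + (x + k) / n * n   ∎

progression-distinct : ∀ {n s} .{{_ : NonZero n}} → Coprime n s →
  ∀ x {i j} → i < j → j < n → (x + i * s) % n ≢ (x + j * s) % n
progression-distinct {n} {s} n⊥s x {i} i<j j<n same with m≤n⇒∃[o]m+o≡n i<j
... | d , refl = <⇒≱ j<n (≤-trans (∣⇒≤ n∣1+d) (s≤s (m≤n+m d i)))
  where
  shift : ∀ x i d s → x + i * s + suc d * s ≡ x + (suc i + d) * s
  shift = solve-∀
  n∣1+d : n ∣ suc d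
  n∣1+d = coprime-divisor n⊥s (subst (n ∣_) (*-comm (suc d) s)
            (mod-cancel (x + i * s) (suc d * s) n (trans (cong (_% n) (shift x i d s)) (sym same))))

modular-inverse : ∀ {m s} → Coprime (suc m) s → ∃ λ u → (u * s) % suc m ≡ 1 % suc m
modular-inverse {m} {s} m+1⊥s with coprime-Bézout m+1⊥s
... | Bézout.-+ x y 1+x[m+1]≡ys = y , (begin
  (y * s) % suc m            ≡⟨ cong (_% suc m) 1+x[m+1]≡ys ⟨
  (1 + x * suc m) % suc m    ≡⟨ [m+kn]%n≡m%n 1 x (suc m) ⟩
  1 % suc m                  ∎)
... | Bézout.+- x y 1+ys≡x[m+1] = m * y , (begin
  (m * y * s) % suc m              ≡⟨ [m+n]%n≡m%n (m * y * s) (suc m) ⟨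
  (m * y * s + suc m) % suc m      ≡⟨ cong (_% suc m) lifted ⟩
  (1 + m * x * suc m) % suc m      ≡⟨ [m+kn]%n≡m%n 1 (m * x) (suc m) ⟩
  1 % suc m                        ∎)
  where
  expand : ∀ m y s → m * y * s + suc m ≡ 1 + m * (1 + y * s)
  expand = solve-∀
  lifted : m * y * s + suc m ≡ 1 + m * x * suc m
  lifted = begin
    m * y * s + suc m      ≡⟨ expand m y s ⟩
    1 + m * (1 + y * s)    ≡⟨ cong (λ z → 1 + m * z) 1+ys≡x[m+1] ⟩
    1 + m * (x * suc m)    ≡⟨ cong (1 +_) (*-assoc m x (suc m)) ⟨
    1 + m * x * suc m      ∎

progression-hits : ∀ {m s} → Coprime (suc m) s →
  ∀ x r → ∃ λ i → i < suc m × (x + i * s) % suc m ≡ (x + r) % suc m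
progression-hits {m} {s} m+1⊥s x r with modular-inverse m+1⊥s
... | u , us≡1 = (r * u) % N , m%n<n (r * u) N , (begin
  (x + (r * u) % N * s) % N     ≡⟨ %-absorb x (r * u) s N ⟩
  (x + r * u * s) % N           ≡⟨ cong (λ z → (x + z) % N) (reorder r u s) ⟩
  (x + u * s * r) % N           ≡⟨ %-absorb x (u * s) r N ⟨
  (x + (u * s) % N * r) % N     ≡⟨ cong (λ z → (x + z * r) % N) us≡1 ⟩
  (x + 1 % N * r) % N           ≡⟨ %-absorb x 1 r N ⟩
  (x + 1 * r) % N               ≡⟨ cong (λ z → (x + z) % N) (*-identityˡ r) ⟩
  (x + r) % N                   ∎)
  where
  N = suc m
  reorder : ∀ r u s → r * u * s ≡ u * s * r
  reorder = solve-∀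

progression-walk : ∀ (f g : ℕ → ℕ) {n} .{{_ : NonZero n}} (s stop : ℕ) →
  (∀ r → r < n → r ≢ stop → f (g r) ≡ g ((r + s) % n)) →
  ∀ x i → (∀ j → j < i → (x + j * s) % n ≢ stop) →
  Reach f (g (x % n)) (g ((x + i * s) % n))
progression-walk f g {n} s stop step x zero    _      = 0 , cong (λ z → g (z % n)) (sym (+-identityʳ x))
progression-walk f g {n} s stop step x (suc i) avoids =
  reach-trans (progression-walk f g s stop step x i (λ j j<i → avoids j (m<n⇒m<1+n j<i)))
              (reach-step (begin
    f (g r)                  ≡⟨ step r (m%n<n (x + i * s) n) (avoids i (n<1+n i)) ⟩
    g ((r + s) % n)          ≡⟨ cong g (%-absorb-+ (x + i * s) s n) ⟩
    g ((x + i * s + s) % n)  ≡⟨ cong (λ z → g (z % n)) (next x i s) ⟩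
    g ((x + suc i * s) % n)  ∎))
  where
  r = (x + i * s) % n
  next : ∀ x i s → x + i * s + s ≡ x + (s + i * s)
  next = solve-∀

≤ᵇ-true : ∀ {m n} → m ≤ n → (m ≤ᵇ n) ≡ true
≤ᵇ-true {m} {n} m≤n with m ≤ᵇ n in eq
... | true  = refl
... | false = ⊥-elim (subst T eq (≤⇒≤ᵇ m≤n))

≤ᵇ-false : ∀ {m n} → n < m → (m ≤ᵇ n) ≡ false
≤ᵇ-false {m} {n} n<m with m ≤ᵇ n in eq
... | false = refl
... | true  = ⊥-elim (<⇒≱ n<m (≤ᵇ⇒≤ m n (subst T (sym eq) tt)))

reflect : ∀ {x y m} → x + y ≡ m → m ∸ x ≡ y
reflect {x} {y} refl = m+n∸m≡n x y

odd : ℕ → ℕ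
odd u = 1 + 2 * u

odd≤double : ∀ {u m} → u < m → odd u ≤ 2 * m
odd≤double u<m = *-monoʳ-< 2 u<m

double<odd : ∀ {m u} → m ≤ u → 2 * m < odd u
double<odd m≤u = s≤s (*-monoʳ-≤ 2 m≤u)

odd+double : ∀ t u {σ} → t + u ≡ σ → odd u + 2 * t ≡ 1 + 2 * σ
odd+double t u refl = shuffle t u
  where
  shuffle : ∀ t u → 1 + 2 * u + 2 * t ≡ 1 + 2 * (t + u)
  shuffle = solve-∀

double+odd : ∀ t u {σ} → t + u ≡ σ → 2 * t + odd u ≡ 1 + 2 * σ
double+odd t u refl = shuffle t u
  where
  shuffle : ∀ t u → 2 * t + (1 + 2 * u) ≡ 1 + 2 * (t + u)
  shuffle = solve-∀

parity : ∀ j → (∃ λ w → j ≡ odd w) ⊎ (∃ λ t → j ≡ 2 * t)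
parity zero = inj₂ (0 , refl)
parity (suc j) with parity j
... | inj₁ (w , refl) = inj₂ (suc w , cong suc (sym (+-suc w (w + 0))))
... | inj₂ (t , refl) = inj₁ (t , refl)

double-positive : ∀ {t} → 1 ≤ 2 * t → 0 < t
double-positive {suc t} _ = z<s

module Blocks (α β γ : ℕ) where

  Q : ℕ → ℕ
  Q = triplePerm (2 * α) (2 * β) (2 * γ)

  2α+2β : 2 * (α + β) ≡ 2 * α + 2 * β
  2α+2β = *-distribˡ-+ 2 α β

  first-block : ∀ {x y} → x ≤ 2 * α → x + y ≡ 1 + 2 * (α + β + γ) → Q x ≡ y
  first-block {x} x≤a sum rewrite ≤ᵇ-true x≤a = reflect (trans sum (halve α β γ))
    where
    halve : ∀ α β γ → 1 + 2 * (α + β + γ) ≡ 2 * α + 2 * β + 2 * γ + 1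
    halve = solve-∀

  second-block : ∀ {x y} → 2 * α < x → x ≤ 2 * α + 2 * β →
                 x + y ≡ 1 + 2 * (α + β) → Q x ≡ y
  second-block {x} a<x x≤a+b sum rewrite ≤ᵇ-false a<x | ≤ᵇ-true x≤a+b =
    reflect (trans sum (halve α β))
    where
    halve : ∀ α β → 1 + 2 * (α + β) ≡ 2 * α + 2 * β + 1
    halve = solve-∀

  third-block : ∀ {x y} → 2 * α + 2 * β < x →
                x + y ≡ 1 + 2 * (α + β + γ + β) → Q x ≡ y
  third-block {x} a+b<x sum
    rewrite ≤ᵇ-false (≤-trans (s≤s (m≤m+n (2 * α) (2 * β))) a+b<x) | ≤ᵇ-false a+b<x =
    reflect (trans sum (halve α β γ))
    where
    halve : ∀ α β γ → 1 + 2 * (α + β + γ + β) ≡ 2 * α + 2 * β + 2 * γ + 2 * β + 1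
    halve = solve-∀

  block₁-odd : ∀ {u t} → u < α → t + u ≡ α + β + γ → Q (odd u) ≡ 2 * t
  block₁-odd {u} {t} u<α sum = first-block (odd≤double u<α) (odd+double t u sum)

  block₁-even : ∀ {t u} → t ≤ α → t + u ≡ α + β + γ → Q (2 * t) ≡ odd u
  block₁-even {t} {u} t≤α sum = first-block (*-monoʳ-≤ 2 t≤α) (double+odd t u sum)

  block₂-odd : ∀ {u t} → α ≤ u → u < α + β → t + u ≡ α + β → Q (odd u) ≡ 2 * t
  block₂-odd {u} {t} α≤u u<α+β sum =
    second-block (double<odd α≤u) (subst (odd u ≤_) 2α+2β (odd≤double u<α+β)) (odd+double t u sum)

  block₂-even : ∀ {t u} → α < t → t ≤ α + β → t + u ≡ α + β → Q (2 * t) ≡ odd u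
  block₂-even {t} {u} α<t t≤α+β sum =
    second-block (*-monoʳ-< 2 α<t) (subst (2 * t ≤_) 2α+2β (*-monoʳ-≤ 2 t≤α+β)) (double+odd t u sum)

  block₃-odd : ∀ {u t} → α + β ≤ u → t + u ≡ α + β + γ + β → Q (odd u) ≡ 2 * t
  block₃-odd {u} {t} α+β≤u sum = third-block (subst (_< odd u) 2α+2β (double<odd α+β≤u)) (odd+double t u sum)

  block₃-even : ∀ {t u} → α + β < t → t + u ≡ α + β + γ + β → Q (2 * t) ≡ odd u
  block₃-even {t} {u} α+β<t sum = third-block (subst (_< 2 * t) 2α+2β (*-monoʳ-< 2 α+β<t)) (double+odd t u sum)

-- The triples (2K, 2B, 2C) with B = 1 + p, C = 1 + q coprime and B + C = K + 1.
-- Writing N = B + C, the map Q² acts on the odd numbers as follows: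
-- on the lower half odd w (w < K) it is the translation w ↦ w + B (mod N), a
-- residue N − 1 = K meaning the start of the upper half; on the upper half
-- odd (K + v) (v < N) it is v ↦ v + C (mod N), except at v = B, whence Q²
-- jumps back to the lower half at odd (B − 1).
module SpecialTriple (p q : ℕ) (B⊥C : Coprime (suc p) (suc q)) where

  B C K N : ℕ
  B = suc p
  C = suc q
  K = p + C
  N = B + C

  open Blocks K B C public

  upper : ℕ → ℕ
  upper v = odd (K + v)

  hub : ℕ
  hub = upper 0

  C≤K : C ≤ K
  C≤K = m≤n+m C p

  B≤K : B ≤ K
  B≤K = subst (B ≤_) (sym (+-suc p q)) (s≤s (m≤m+n p q))

  K<N : K < N
  K<N = n<1+n K

  p<N : p < N
  p<N = m≤m+n B C

  N⊥B : Coprime N B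
  N⊥B = coprime-+ (coprime-sym B⊥C)

  N⊥C : Coprime N C
  N⊥C = subst (λ n → Coprime n C) (+-comm C B) (coprime-+ B⊥C)

  square-lower-small : ∀ {w} → w < C → twice Q (odd w) ≡ odd (w + B)
  square-lower-small {w} w<C with m≤n⇒∃[o]m+o≡n w<C
  ... | d , 1+w+d≡C =
    trans (cong Q (block₁-odd {t = t} (≤-trans w<C C≤K) into)) (block₃-even {t = t} (m<m+n (K + B) z<s) out)
    where
    t = K + B + suc d
    into : t + w ≡ K + B + C
    into = trans (shuffle (K + B) w d) (cong (K + B +_) 1+w+d≡C)
      where
      shuffle : ∀ k w d → k + suc d + w ≡ k + (suc w + d)
      shuffle = solve-∀
    out : t + (w + B) ≡ K + B + C + B
    out = trans (shuffle (K + B) B w d) (cong (λ z → K + B + z + B) 1+w+d≡C)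
      where
      shuffle : ∀ k b w d → k + suc d + (w + b) ≡ k + (suc w + d) + b
      shuffle = solve-∀

  square-lower-large : ∀ {s} → s < p → twice Q (odd (C + s)) ≡ odd s
  square-lower-large {s} s<p with m≤n⇒∃[o]m+o≡n s<p
  ... | e , 1+s+e≡p = trans (cong Q (block₁-odd {t = t} C+s<K into)) (block₂-even {t = t} K<t t≤K+B t+s≡K+B)
    where
    t = N + suc e
    C+s<K : C + s < K
    C+s<K = subst (C + s <_) (+-comm C p) (+-monoʳ-< C s<p)
    into : t + (C + s) ≡ K + B + C
    into = trans (shuffle B C e s) (cong (λ z → z + C + B + C) 1+s+e≡p)
      where
      shuffle : ∀ b c e s → b + c + suc e + (c + s) ≡ suc s + e + c + b + c
      shuffle = solve-∀
    t+s≡K+B : t + s ≡ K + B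
    t+s≡K+B = trans (shuffle B C e s) (cong (λ z → z + C + B) 1+s+e≡p)
      where
      shuffle : ∀ b c e s → b + c + suc e + s ≡ suc s + e + c + b
      shuffle = solve-∀
    K<t : K < t
    K<t = ≤-trans K<N (m≤m+n N (suc e))
    t≤K+B : t ≤ K + B
    t≤K+B = subst (t ≤_) t+s≡K+B (m≤m+n t s)

  square-upper-small : ∀ {v} → v < B → twice Q (upper v) ≡ upper (v + C)
  square-upper-small {v} v<B with m≤n⇒∃[o]m+o≡n v<B
  ... | e , 1+v+e≡B =
    trans (cong Q (block₂-odd {t = t} (m≤m+n K v) (+-monoʳ-< K v<B) into)) (block₁-even {t = t} t≤K out)
    where
    t = suc e
    into : t + (K + v) ≡ K + B
    into = trans (shuffle K v e) (cong (K +_) 1+v+e≡B)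
      where
      shuffle : ∀ k v e → suc e + (k + v) ≡ k + (suc v + e)
      shuffle = solve-∀
    out : t + (K + (v + C)) ≡ K + B + C
    out = trans (shuffle K v e C) (cong (λ z → K + z + C) 1+v+e≡B)
      where
      shuffle : ∀ k v e c → suc e + (k + (v + c)) ≡ k + (suc v + e) + c
      shuffle = solve-∀
    t≤K : t ≤ K
    t≤K = ≤-trans (subst (t ≤_) 1+v+e≡B (s≤s (m≤n+m e v))) B≤K

  square-exit : twice Q (upper B) ≡ odd p
  square-exit = trans (cong Q (block₃-odd {t = N} ≤-refl (into K B C))) (block₂-even {t = N} K<N N≤K+B (out p q))
    where
    into : ∀ k b c → b + c + (k + b) ≡ k + b + c + b
    into = solve-∀
    out : ∀ p q → suc p + suc q + p ≡ p + suc q + suc p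
    out = solve-∀
    N≤K+B : N ≤ K + B
    N≤K+B = subst (N ≤_) (sym (+-suc K p)) (s≤s (m≤m+n K p))

  square-upper-large : ∀ {s} → suc s < C → twice Q (upper (suc B + s)) ≡ upper (suc s)
  square-upper-large {s} 1+s<C with m≤n⇒∃[o]m+o≡n 1+s<C
  ... | e , 2+s+e≡C = trans (cong Q (block₃-odd {t = t} K+B≤ into)) (block₁-even {t = t} t≤K out)
    where
    t = B + suc e
    K+B≤ : K + B ≤ K + (suc B + s)
    K+B≤ = +-monoʳ-≤ K (≤-trans (n≤1+n B) (m≤m+n (suc B) s))
    into : t + (K + (suc B + s)) ≡ K + B + C + B
    into = trans (shuffle K B e s) (cong (λ z → K + B + z + B) 2+s+e≡C)
      where
      shuffle : ∀ k b e s → b + suc e + (k + (suc b + s)) ≡ k + b + (suc (suc s) + e) + b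
      shuffle = solve-∀
    out : t + (K + suc s) ≡ K + B + C
    out = trans (shuffle K B e s) (cong (K + B +_) 2+s+e≡C)
      where
      shuffle : ∀ k b e s → b + suc e + (k + suc s) ≡ k + b + (suc (suc s) + e)
      shuffle = solve-∀
    t≤K : t ≤ K
    t≤K = subst (t ≤_) (trans (shuffle p e s) (cong (p +_) 2+s+e≡C)) (m≤m+n t s)
      where
      shuffle : ∀ p e s → suc p + suc e + s ≡ p + (suc (suc s) + e)
      shuffle = solve-∀

  lower-step : ∀ r → r < N → r ≢ K → twice Q (odd r) ≡ odd ((r + B) % N)
  lower-step r r<N r≢K with r <? C
  ... | yes r<C = trans (square-lower-small r<C) (cong odd (sym (m<n⇒m%n≡m r+B<N)))
    where
    r+B<N : r + B < N
    r+B<N = subst (r + B <_) (+-comm C B) (+-monoˡ-< B r<C)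
  ... | no r≮C with m≤n⇒∃[o]m+o≡n (≮⇒≥ r≮C)
  ...   | s , refl = trans (square-lower-large s<p) (cong odd (sym wraps))
    where
    s<p : s < p
    s<p = +-cancelˡ-< C s p (subst (C + s <_) (+-comm p C) (≤∧≢⇒< (s≤s⁻¹ r<N) r≢K))
    rotate : ∀ c s b → c + s + b ≡ s + (b + c)
    rotate = solve-∀
    wraps : (C + s + B) % N ≡ s
    wraps = begin
      (C + s + B) % N  ≡⟨ cong (_% N) (rotate C s B) ⟩
      (s + N) % N      ≡⟨ [m+n]%n≡m%n s N ⟩
      s % N            ≡⟨ m<n⇒m%n≡m (<-trans s<p p<N) ⟩
      s                ∎

  upper-step : ∀ v → v < N → v ≢ B → twice Q (upper v) ≡ upper ((v + C) % N)
  upper-step v v<N v≢B with <-cmp v B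
  ... | tri< v<B _ _ = trans (square-upper-small v<B) (cong upper (sym (m<n⇒m%n≡m (+-monoˡ-< C v<B))))
  ... | tri≈ _ v≡B _ = ⊥-elim (v≢B v≡B)
  ... | tri> _ _ B<v with m≤n⇒∃[o]m+o≡n B<v
  ...   | s , refl = trans (square-upper-large 1+s<C) (cong upper (sym wraps))
    where
    1+s<C : suc s < C
    1+s<C = +-cancelˡ-< B (suc s) C (subst (_< N) (sym (+-suc B s)) v<N)
    rotate : ∀ b s c → suc b + s + c ≡ suc s + (b + c)
    rotate = solve-∀
    wraps : (suc B + s + C) % N ≡ suc s
    wraps = begin
      (suc B + s + C) % N  ≡⟨ cong (_% N) (rotate B s C) ⟩
      (suc s + N) % N      ≡⟨ [m+n]%n≡m%n (suc s) N ⟩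
      suc s % N            ≡⟨ m<n⇒m%n≡m (<-≤-trans 1+s<C (m≤n+m C B)) ⟩
      suc s                ∎

  B≡KC : B ≡ (K * C) % N
  B≡KC = sym (begin
    (K * C) % N      ≡⟨ cong (_% N) (expand p q) ⟩
    (B + q * N) % N  ≡⟨ [m+kn]%n≡m%n B q N ⟩
    B % N            ≡⟨ m<n⇒m%n≡m (m<m+n B z<s) ⟩
    B                ∎)
    where
    expand : ∀ p q → (p + suc q) * suc q ≡ suc p + q * (suc p + suc q)
    expand = solve-∀

  lower-wraps : ∀ {w} → w < N → (K + suc w) % N ≡ w
  lower-wraps {w} w<N = begin
    (K + suc w) % N  ≡⟨ cong (_% N) (+-suc K w) ⟩
    (suc K + w) % N  ≡⟨ cong (_% N) (+-comm N w) ⟩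
    (w + N) % N      ≡⟨ [m+n]%n≡m%n w N ⟩
    w % N            ≡⟨ m<n⇒m%n≡m w<N ⟩
    w                ∎

  lower-base : (K + 0 * B) % N ≡ K
  lower-base = trans (cong (_% N) (+-identityʳ K)) (m<n⇒m%n≡m K<N)

  -- From the hub = upper 0, Q² runs through upper C, upper 2C, …, upper KC:
  -- these first K + 1 terms avoid the exit residue B = KC.
  upper-walk : ∀ {i} → i ≤ K → Reach (twice Q) hub (upper ((i * C) % N))
  upper-walk {i} i≤K = progression-walk (twice Q) upper C B upper-step 0 i avoids
    where
    avoids : ∀ j → j < i → (0 + j * C) % N ≢ B
    avoids j j<i jC≡B = progression-distinct N⊥C 0 (<-≤-trans j<i i≤K) K<N (trans jC≡B B≡KC)

  -- Q² runs through the lower terms odd (K + iB mod N), 0 < i ≤ N, which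
  -- avoid the residue K = K + 0·B except for the last one.
  lower-walk : ∀ {i} d → 0 < i → i + d ≤ N →
    Reach (twice Q) (odd ((K + i * B) % N)) (odd ((K + (i + d) * B) % N))
  lower-walk {i} d 0<i i+d≤N =
    subst (Reach (twice Q) (odd ((K + i * B) % N)) ∘ odd ∘ (_% N)) (regroup K i d B)
          (progression-walk (twice Q) odd B K lower-step (K + i * B) d avoids)
    where
    regroup : ∀ k i d b → k + i * b + d * b ≡ k + (i + d) * b
    regroup = solve-∀
    avoids : ∀ j → j < d → (K + i * B + j * B) % N ≢ K
    avoids j j<d hit =
      progression-distinct N⊥B K (≤-trans 0<i (m≤m+n i j)) (<-≤-trans (+-monoʳ-< i j<d) i+d≤N)
      (begin
        (K + 0 * B) % N        ≡⟨ lower-base ⟩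
        K                      ≡⟨ hit ⟨
        (K + i * B + j * B) % N ≡⟨ cong (_% N) (regroup K i j B) ⟩
        (K + (i + j) * B) % N  ∎)

  -- From the hub, the upper walk ends at upper B, and Q² leaves for odd p,
  -- which is the first term of the lower walk.
  hub-to-lower : Reach (twice Q) hub (odd ((K + 1 * B) % N))
  hub-to-lower = reach-trans
    (subst (Reach (twice Q) hub ∘ upper) (sym B≡KC) (upper-walk ≤-refl))
    (reach-step (trans square-exit (cong odd (sym first))))
    where
    shift : ∀ p q → p + suc q + 1 * suc p ≡ p + (suc p + suc q)
    shift = solve-∀
    first : (K + 1 * B) % N ≡ p
    first = trans (cong (_% N) (shift p q)) (trans ([m+n]%n≡m%n p N) (m<n⇒m%n≡m p<N))

  hub-reaches-upper : ∀ {v} → v ≤ K → Reach (twice Q) hub (upper v)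
  hub-reaches-upper {v} v≤K = from-index (progression-hits N⊥C 0 v)
    where
    from-index : (∃ λ i → i < N × (i * C) % N ≡ v % N) → Reach (twice Q) hub (upper v)
    from-index (i , i<N , hit) =
      subst (Reach (twice Q) hub ∘ upper) (trans hit (m<n⇒m%n≡m (s≤s v≤K))) (upper-walk (s≤s⁻¹ i<N))

  hub-reaches-lower : ∀ {w} → w < K → Reach (twice Q) hub (odd w)
  hub-reaches-lower {w} w<K = from-index (progression-hits N⊥B K (suc w))
    where
    wraps : (K + suc w) % N ≡ w
    wraps = lower-wraps (<-trans w<K K<N)
    from-index : (∃ λ i → i < N × (K + i * B) % N ≡ (K + suc w) % N) → Reach (twice Q) hub (odd w)
    from-index (zero  , _   , hit) = ⊥-elim (<⇒≢ w<K (sym (trans (sym lower-base) (trans hit wraps))))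
    from-index (suc i , i<N , hit) = reach-trans hub-to-lower
      (subst (Reach (twice Q) _ ∘ odd) (trans hit wraps) (lower-walk i z<s (<⇒≤ i<N)))

  one-reaches-hub : Reach (twice Q) 1 hub
  one-reaches-hub = from-index (progression-hits N⊥B K 1)
    where
    start : ∀ {i} → (K + i * B) % N ≡ (K + 1) % N → odd ((K + i * B) % N) ≡ 1
    start hit = cong odd (trans hit (lower-wraps z<s))
    end : ∀ {m} → m ≡ N → odd ((K + m * B) % N) ≡ hub
    end {m} m≡N = cong odd (begin
      (K + m * B) % N  ≡⟨ cong (λ z → (K + z * B) % N) m≡N ⟩
      (K + N * B) % N  ≡⟨ cong (λ z → (K + z) % N) (*-comm N B) ⟩
      (K + B * N) % N  ≡⟨ [m+kn]%n≡m%n K B N ⟩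
      K % N            ≡⟨ m<n⇒m%n≡m K<N ⟩
      K                ≡⟨ +-identityʳ K ⟨
      K + 0            ∎)
    from-index : (∃ λ i → i < N × (K + i * B) % N ≡ (K + 1) % N) → Reach (twice Q) 1 hub
    from-index (zero  , _   , hit) = ⊥-elim (m+1+n≢0 p (trans (sym lower-base) (trans hit (lower-wraps z<s))))
    from-index (suc i , i<N , hit) =
      let (d , 1+i+d≡N) = m≤n⇒∃[o]m+o≡n (<⇒≤ i<N)
      in subst₂ (Reach (twice Q)) (start {suc i} hit) (end 1+i+d≡N) (lower-walk d z<s (≤-reflexive 1+i+d≡N))

  odd-reachable : ∀ {w} → w ≤ K + K → Reach Q 1 (odd w)
  odd-reachable {w} w≤2K = reach-twice (reach-trans one-reaches-hub (from-hub (w <? K)))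
    where
    from-hub : Dec (w < K) → Reach (twice Q) hub (odd w)
    from-hub (yes w<K) = hub-reaches-lower w<K
    from-hub (no w≮K) =
      let (v , K+v≡w) = m≤n⇒∃[o]m+o≡n (≮⇒≥ w≮K)
      in subst (Reach (twice Q) hub ∘ odd) K+v≡w
           (hub-reaches-upper (+-cancelˡ-≤ K v K (subst (_≤ K + K) (sym K+v≡w) w≤2K)))

  Preimage : ℕ → Set
  Preimage t = ∃ λ w → w ≤ K + K × Q (odd w) ≡ 2 * t

  preimage-low : ∀ {t} → 0 < t → t ≤ B → Preimage t
  preimage-low {t} 0<t t≤B with m≤n⇒∃[o]m+o≡n t≤B
  ... | s , t+s≡B =
    K + s , +-monoʳ-≤ K (≤-trans (<⇒≤ s<B) B≤K) , block₂-odd {t = t} (m≤m+n K s) (+-monoʳ-< K s<B) sum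
    where
    s<B : s < B
    s<B = subst (s <_) t+s≡B (m<n+m s 0<t)
    shuffle : ∀ k t s → t + (k + s) ≡ k + (t + s)
    shuffle = solve-∀
    sum : t + (K + s) ≡ K + B
    sum = trans (shuffle K t s) (cong (K +_) t+s≡B)

  preimage-mid : ∀ {r} → suc B + r ≤ N → Preimage (suc B + r)
  preimage-mid {r} t≤N with m≤n⇒∃[o]m+o≡n (+-cancelˡ-≤ B (suc r) C (subst (_≤ N) (sym (+-suc B r)) t≤N))
  ... | s , 1+r+s≡C = K + B + s , bound , block₃-odd {t = suc B + r} (m≤m+n (K + B) s) sum
    where
    shuffle : ∀ k b r s → suc b + r + (k + b + s) ≡ k + b + (suc r + s) + b
    shuffle = solve-∀
    sum : suc B + r + (K + B + s) ≡ K + B + C + B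
    sum = trans (shuffle K B r s) (cong (λ z → K + B + z + B) 1+r+s≡C)
    shuffle′ : ∀ p r s → suc p + s + r ≡ p + (suc r + s)
    shuffle′ = solve-∀
    B+s≤K : B + s ≤ K
    B+s≤K = subst (B + s ≤_) (trans (shuffle′ p r s) (cong (p +_) 1+r+s≡C)) (m≤m+n (B + s) r)
    bound : K + B + s ≤ K + K
    bound = ≤-trans (≤-reflexive (+-assoc K B s)) (+-monoʳ-≤ K B+s≤K)

  preimage-high : ∀ {r} → suc N + r ≤ K + N → Preimage (suc N + r)
  preimage-high {r} t≤K+N with m≤n⇒∃[o]m+o≡n r<K
    where
    r<K : r < K
    r<K = +-cancelˡ-≤ N (suc r) K (subst₂ _≤_ (sym (+-suc N r)) (+-comm K N) t≤K+N)
  ... | u , 1+r+u≡K = u , bound , block₁-odd {t = suc N + r} (subst (u <_) 1+r+u≡K (m<n+m u z<s)) sum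
    where
    bound : u ≤ K + K
    bound = ≤-trans (m≤n+m u (suc r)) (subst (_≤ K + K) (sym 1+r+u≡K) (m≤m+n K K))
    shuffle : ∀ b c r u → suc (b + c) + r + u ≡ suc r + u + b + c
    shuffle = solve-∀
    sum : suc N + r + u ≡ K + B + C
    sum = trans (shuffle B C r u) (cong (λ z → z + B + C) 1+r+u≡K)

  even-preimage : ∀ {t} → 0 < t → t ≤ K + N → Preimage t
  even-preimage {t} 0<t t≤K+N with t ≤? B | t ≤? N
  ... | yes t≤B | _       = preimage-low 0<t t≤B
  ... | no t≰B  | yes t≤N with m≤n⇒∃[o]m+o≡n (≰⇒> t≰B)
  ...   | r , refl = preimage-mid t≤N
  even-preimage {t} 0<t t≤K+N | no _ | no t≰N with m≤n⇒∃[o]m+o≡n (≰⇒> t≰N)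
  ...   | r , refl = preimage-high t≤K+N

  n≡2[K+N] : 2 * K + 2 * B + 2 * C ≡ 2 * (K + N)
  n≡2[K+N] = collect K B C
    where
    collect : ∀ k b c → 2 * k + 2 * b + 2 * c ≡ 2 * (k + (b + c))
    collect = solve-∀

  good : Good (2 * K) (2 * B) (2 * C)
  good j 1≤j j≤n = by-parity (parity j)
    where
    by-parity : (∃ λ w → j ≡ odd w) ⊎ (∃ λ t → j ≡ 2 * t) → Reach Q 1 j
    by-parity (inj₁ (w , j≡odd)) = subst (Reach Q 1) (sym j≡odd) (odd-reachable w≤2K)
      where
      w≤2K : w ≤ K + K
      w≤2K = s≤s⁻¹ (subst (w <_) (+-suc K K)
               (*-cancelˡ-< 2 w (K + N) (subst₂ _≤_ j≡odd n≡2[K+N] j≤n)))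
    by-parity (inj₂ (t , j≡2t)) =
      let (w , w≤2K , Qw≡2t) = even-preimage {t} (double-positive (subst (1 ≤_) j≡2t 1≤j))
                                 (*-cancelˡ-≤ 2 (subst₂ _≤_ j≡2t n≡2[K+N] j≤n))
      in subst (Reach Q 1) (sym j≡2t) (reach-trans (odd-reachable w≤2K) (reach-step Qw≡2t))

half-sum : ∀ p q K → suc p * 2 + suc q * 2 ≡ 2 * K + 2 → p + suc q ≡ K
half-sum p q K b+c≡2K+2 =
  *-cancelˡ-≡ (p + suc q) K 2 (+-cancelʳ-≡ 2 (2 * (p + suc q)) (2 * K) (trans (regroup p q) b+c≡2K+2))
  where
  regroup : ∀ p q → 2 * (p + suc q) + 2 ≡ suc p * 2 + suc q * 2
  regroup = solve-∀

coprime-halves : ∀ m n → gcd (m * 2) (n * 2) ≡ 2 → Coprime m n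
coprime-halves m n gcd≡2 = gcd≡1⇒coprime (*-cancelˡ-≡ (gcd m n) 1 2 (begin
  2 * gcd m n          ≡⟨ c*gcd[m,n]≡gcd[cm,cn] 2 m n ⟩
  gcd (2 * m) (2 * n)  ≡⟨ cong₂ gcd (*-comm 2 m) (*-comm 2 n) ⟩
  gcd (m * 2) (n * 2)  ≡⟨ gcd≡2 ⟩
  2                    ∎))

theorem16 : (K a b c : ℕ) → 0 < K → 0 < a → 0 < b → 0 < c →
            a ≡ 2 * K → b ≤ a → c ≤ a → b + c ≡ 2 * K + 2 →
            2 ∣ b → 2 ∣ c → gcd b c ≡ 2 →
            Good a b c
theorem16 K a b c _ _ () _ refl _ _ _ (divides zero refl) _ _
theorem16 K a b c _ _ _ () refl _ _ _ (divides (suc p) refl) (divides zero refl) _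
theorem16 K a b c _ _ _ _ refl _ _ b+c≡2K+2 (divides (suc p) refl) (divides (suc q) refl) gcd≡2
  with half-sum p q K b+c≡2K+2
... | refl = subst₂ (Good (2 * (p + suc q))) (*-comm 2 (suc p)) (*-comm 2 (suc q))
               (SpecialTriple.good p q (coprime-halves (suc p) (suc q) gcd≡2))
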